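{- Let $1\le l\le r$ be integers, let $i_1,\dots,i_k\in\{l,\dots,r\}$, and let $S\subseteq\{l,\dots,r\}$. Then the graph $\mathcal{T}_{l,r}^{\{i_1\},\dots,\{i_k\}}(-S)$ has a perfect matching if and only if $S=\{l,\dots,r\}\setminus\{i_1,\dots,i_k\}$ and $|S|=r-l+1-k$.
   Context: For integers $r\ge l\ge1$, the rooted tree $\mathcal{T}_{l,r}$ is defined recursively: if $l=r$ it consists only of a root labeled $\{l\}$; if $l<r$, it consists of a root labeled $\{l,\dots,r\}$ with a single (unlabeled) child vertex whose two children are the roots of $\mathcal{T}_{l,\lfloor (l+r)/2\rfloor}$ and $\mathcal{T}_{\lfloor (l+r)/2\rfloor+1,r}$. Every labeled vertex is labeled by the set of its descendant leaves; the leaves are the vertices labeled $\{i\}$. Let $\mathcal{L}_{l,r}$ be the set of labels of $\mathcal{T}_{l,r}$. For $a_1,\dots,a_k\in\mathcal{L}_{l,r}$, $\mathcal{T}_{l,r}^{a_1,\dots,a_k}$ is $\mathcal{T}_{l,r}$ together with $k$ new "switch" vertices, the $t$-th of which is joined by a single edge to the vertex with label $a_t$. For $S\subseteq\{l,\dots,r\}$, $\mathcal{T}_{l,r}^{a_1,\dots,a_k}(-S)$ is this graph with the vertices labeled $\{i\}$, $i\in S$, removed. -}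

module Defs where

open import Data.Nat using (ℕ; zero; suc; _+_; _≤_; _<_; ⌊_/2⌋)
open import Data.Nat.Properties using () renaming (_≟_ to _≟ℕ_)
open import Data.Fin using (Fin)
open import Data.Fin.Properties using () renaming (_≟_ to _≟F_)
open import Data.Vec using (Vec; lookup)
open import Data.List using (List; []; _∷_)
open import Data.List.Membership.Propositional using (_∈_)
open import Data.List.Relation.Unary.All using (All)
open import Data.Product using (_×_; _,_; proj₁; proj₂)
open import Data.Sum using (_⊎_)
open import Relation.Nullary using (¬_; Dec; yes; no)
open import Relation.Nullary.Decidable using (_⊎-dec_)
open import Relation.Binary.PropositionalEquality using (_≡_; refl; cong; cong₂)

mid : ℕ → ℕ → ℕ
mid l r = ⌊ l + r /2⌋

-- InTree l r a b : the label {a,…,b} occurs in 𝒯_{l,r}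
-- (labeled vertices of 𝒯_{l,r} are identified by their label intervals [a,b]).
data InTree : ℕ → ℕ → ℕ → ℕ → Set where
  here  : ∀ {l r} → InTree l r l r
  left  : ∀ {l r a b} → l < r → InTree l (mid l r) a b → InTree l r a b
  right : ∀ {l r a b} → l < r → InTree (suc (mid l r)) r a b → InTree l r a b

-- Candidate vertices of 𝒯^{a₁,…,a_k}_{l,r}(-S):
--   lab a b : the vertex labeled {a,…,b}
--   unl a b : the unlabeled child of the vertex labeled {a,…,b} (only when a < b)
--   sw t    : the t-th switch vertex
data Vtx (k : ℕ) : Set where
  lab : ℕ → ℕ → Vtx k
  unl : ℕ → ℕ → Vtx k
  sw  : Fin k → Vtx k

_≟V_ : ∀ {k} (u v : Vtx k) → Dec (u ≡ v)
lab a b ≟V lab c d with a ≟ℕ c | b ≟ℕ d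
... | yes refl | yes refl = yes refl
... | no p | _ = no λ { refl → p refl }
... | yes _ | no q = no λ { refl → q refl }
lab _ _ ≟V unl _ _ = no λ ()
lab _ _ ≟V sw _ = no λ ()
unl _ _ ≟V lab _ _ = no λ ()
unl a b ≟V unl c d with a ≟ℕ c | b ≟ℕ d
... | yes refl | yes refl = yes refl
... | no p | _ = no λ { refl → p refl }
... | yes _ | no q = no λ { refl → q refl }
unl _ _ ≟V sw _ = no λ ()
sw _ ≟V lab _ _ = no λ ()
sw _ ≟V unl _ _ = no λ ()
sw s ≟V sw t with s ≟F t
... | yes refl = yes refl
... | no p = no λ { refl → p refl }

countDec : ∀ {A : Set} {P : A → Set} → ((x : A) → Dec (P x)) → List A → ℕ
countDec P? [] = 0
countDec P? (x ∷ xs) with P? x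
... | yes _ = suc (countDec P? xs)
... | no  _ = countDec P? xs

module Graph (l r : ℕ) {k : ℕ} (is : Vec ℕ k) (S : List ℕ) where

  IsVertex : Vtx k → Set
  IsVertex (lab a b) = InTree l r a b × ¬ (a ≡ b × a ∈ S)
  IsVertex (unl a b) = InTree l r a b × a < b
  IsVertex (sw t)    = Data.Unit.⊤
    where import Data.Unit

  data BaseEdge : Vtx k → Vtx k → Set where
    lab-unl   : ∀ {a b} → BaseEdge (lab a b) (unl a b)
    unl-left  : ∀ {a b} → BaseEdge (unl a b) (lab a (mid a b))
    unl-right : ∀ {a b} → BaseEdge (unl a b) (lab (suc (mid a b)) b)
    sw-leaf   : ∀ {t} → BaseEdge (sw t) (lab (lookup is t) (lookup is t))

  Edge : Vtx k → Vtx k → Set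
  Edge u v = (BaseEdge u v ⊎ BaseEdge v u) × IsVertex u × IsVertex v

  Incident : Vtx k → Vtx k × Vtx k → Set
  Incident v e = proj₁ e ≡ v ⊎ proj₂ e ≡ v

  incident? : (v : Vtx k) → (e : Vtx k × Vtx k) → Dec (Incident v e)
  incident? v (x , y) = (x ≟V v) ⊎-dec (y ≟V v)

  IsPerfectMatching : List (Vtx k × Vtx k) → Set
  IsPerfectMatching M =
    All (λ e → Edge (proj₁ e) (proj₂ e)) M ×
    (∀ v → IsVertex v → countDec (incident? v) M ≡ 1)

  HasPerfectMatching : Set
  HasPerfectMatching = Data.Product.∃ IsPerfectMatching
    where import Data.Product

{-# OPTIONS --safe #-}
module Submission where

-- In a perfect matching every switch is matched to its leaf, which is therefore not deleted, and
-- distinct switches are matched to distinct leaves. Going down from the root, no labelled vertex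
-- is matched to the unlabelled vertex above it: the root has none, and an internal labelled
-- vertex that is not matched upwards must be matched to the unlabelled vertex below it, which is
-- then taken away from its two children. Hence every surviving leaf is matched to a switch, so
-- the surviving leaves are exactly the i_t, and these are pairwise distinct; both conditions follow.
-- Conversely, under the two conditions the i_t are pairwise distinct by counting, and matching
-- every internal labelled vertex with the unlabelled vertex below it and every switch with its
-- leaf is a perfect matching.

open import Defs
open import Data.Nat using (ℕ; zero; suc; _+_; _∸_; _≤_; _<_; z≤n; s≤s; ⌊_/2⌋; _<?_)
open import Data.Nat.Properties
open import Data.Fin using (Fin; punchOut)
open import Data.Fin.Properties using () renaming (_≟_ to _≟ᶠ_)
open import Data.Maybe using (Maybe; just; nothing; fromMaybe)
open import Data.Maybe.Properties using (just-injective)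
open import Data.Unit using (tt)
open import Data.Vec using (Vec; lookup; toList; removeAt)
open import Data.Vec.Properties using (removeAt-punchOut; length-toList)
open import Data.Vec.Membership.Propositional using () renaming (_∈_ to _∈ᵥ_)
open import Data.Vec.Membership.Propositional.Properties using (∈-toList⁺; ∈-toList⁻)
  renaming (∈-lookup to ∈ᵥ-lookup)
open import Data.Vec.Membership.DecPropositional _≟_ using () renaming (_∈?_ to _∈ᵥ?_)
open import Data.Vec.Relation.Unary.All using () renaming (All to Allᵥ; lookup to lookupᵥ)
import Data.Vec.Relation.Unary.Any as Anyᵥ
open import Data.Vec.Relation.Unary.Any.Properties using (lookup-index)
open import Data.List using (List; []; _∷_; _++_; [_]; length; map; filter; upTo; tabulate; allFin)
open import Data.List.Properties using (length-++; length-map; length-upTo; length-tabulate)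
open import Data.List.Membership.Propositional using (_∈_; _∉_)
open import Data.List.Membership.Propositional.Properties
  using (∈-∃++; ∈-++⁻; ∈-++⁺ˡ; ∈-++⁺ʳ; ∈-map⁺; ∈-map⁻; ∈-upTo⁺; ∈-upTo⁻;
         ∈-tabulate⁺; ∈-tabulate⁻; ∈-allFin; ∈-filter⁺; ∈-filter⁻)
open import Data.List.Membership.DecPropositional _≟_ using () renaming (_∈?_ to _∈ₗ?_)
open import Data.List.Relation.Binary.Subset.Propositional using (_⊆_)
import Data.List.Relation.Binary.Subset.Propositional.Properties as ⊆
open ⊆ using (⊆-trans)
open import Data.List.Relation.Unary.Any using (here; there)
open import Data.List.Relation.Unary.Any.Properties using (singleton⁻)
open import Data.List.Relation.Unary.All as All using (All; []; _∷_)
open import Data.List.Relation.Unary.AllPairs using ([]; _∷_)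
open import Data.List.Relation.Unary.Unique.Propositional using (Unique)
import Data.List.Relation.Unary.Unique.Propositional.Properties as Unique
open import Data.Product using (_×_; _,_; proj₁; proj₂; ∃; uncurry)
open import Data.Sum using (_⊎_; inj₁; inj₂; swap)
open import Function.Base using (_∘_)
open import Function.Bundles using (_⇔_; mk⇔; Equivalence)
open import Relation.Nullary using (¬_; yes; no; contradiction)
open import Relation.Unary using (Decidable)
open import Relation.Binary.PropositionalEquality
  using (_≡_; _≢_; refl; sym; trans; cong; cong₂; subst; module ≡-Reasoning)

-- Unique lists and counting

module _ {A : Set} where

  private
    variable
      x y : A
      xs ys zs : List A

  length-mono-⊆ : Unique xs → xs ⊆ ys → length xs ≤ length ys
  length-mono-⊆ [] _ = z≤n
  length-mono-⊆ {x ∷ xs} (x∉xs ∷ xs-unique) xs⊆ys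
    with as , bs , refl ← ∈-∃++ (xs⊆ys (here refl)) = begin
      suc (length xs)               ≤⟨ s≤s (length-mono-⊆ xs-unique xs⊆as++bs) ⟩
      suc (length (as ++ bs))       ≡⟨ cong suc (length-++ as) ⟩
      suc (length as + length bs)   ≡⟨ +-suc (length as) (length bs) ⟨
      length as + length (x ∷ bs)   ≡⟨ length-++ as ⟨
      length (as ++ x ∷ bs)         ∎
    where
    open ≤-Reasoning
    xs⊆as++bs : xs ⊆ as ++ bs
    xs⊆as++bs y∈xs with ∈-++⁻ as (xs⊆ys (there y∈xs))
    ... | inj₁ y∈as          = ∈-++⁺ˡ y∈as
    ... | inj₂ (here refl)   = contradiction refl (All.lookup x∉xs y∈xs)
    ... | inj₂ (there y∈bs)  = ∈-++⁺ʳ as y∈bs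

  length-cong-⊆⊇ : Unique xs → Unique ys → xs ⊆ ys → ys ⊆ xs → length xs ≡ length ys
  length-cong-⊆⊇ xs-unique ys-unique xs⊆ys ys⊆xs =
    ≤-antisym (length-mono-⊆ xs-unique xs⊆ys) (length-mono-⊆ ys-unique ys⊆xs)

  ∈-removeAt : ∀ {n} (xs : Vec A (suc n)) {i j : Fin (suc n)} (i≢j : i ≢ j) →
               lookup xs j ∈ᵥ removeAt xs i
  ∈-removeAt xs i≢j =
    subst (_∈ᵥ _) (removeAt-punchOut xs i≢j) (∈ᵥ-lookup (punchOut i≢j) (removeAt xs _))

  toList⊆toList-removeAt : ∀ {n} (xs : Vec A (suc n)) {i j : Fin (suc n)} → i ≢ j →
                           lookup xs i ≡ lookup xs j → toList xs ⊆ toList (removeAt xs i)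
  toList⊆toList-removeAt xs {i} i≢j xsᵢ≡xsⱼ x∈xs with x∈ᵥxs ← ∈-toList⁻ x∈xs =
    ∈-toList⁺ (subst (_∈ᵥ _) (sym (lookup-index x∈ᵥxs)) (lookup∈removeAt (Anyᵥ.index x∈ᵥxs)))
    where
    lookup∈removeAt : ∀ h → lookup xs h ∈ᵥ removeAt xs i
    lookup∈removeAt h with h ≟ᶠ i
    ... | yes refl = subst (_∈ᵥ _) (sym xsᵢ≡xsⱼ) (∈-removeAt xs i≢j)
    ... | no h≢i   = ∈-removeAt xs (h≢i ∘ sym)

  -- A repeated entry of xs could be removed, leaving zs ++ toList xs too short to cover ys.
  covering⇒lookup-injective : ∀ {n} (xs : Vec A n) → Unique ys → ys ⊆ zs ++ toList xs →
                              length ys ≡ length zs + n →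
                              ∀ {i j} → lookup xs i ≡ lookup xs j → i ≡ j
  covering⇒lookup-injective {ys} {zs} {suc n} xs ys-unique ys⊆ |ys|≡ {i} {j} xsᵢ≡xsⱼ
    with i ≟ᶠ j
  ... | yes i≡j = i≡j
  ... | no i≢j  = contradiction too-long (<⇒≱ (+-monoʳ-< (length zs) (n<1+n n)))
    where
    open ≤-Reasoning
    too-long : length zs + suc n ≤ length zs + n
    too-long = begin
      length zs + suc n                            ≡⟨ |ys|≡ ⟨
      length ys                                    ≤⟨ length-mono-⊆ ys-unique ys⊆zs++xs∖i ⟩
      length (zs ++ toList (removeAt xs i))        ≡⟨ length-++ zs ⟩
      length zs + length (toList (removeAt xs i))  ≡⟨ cong (length zs +_) (length-toList (removeAt xs i)) ⟩
      length zs + n                                ∎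
      where
      ys⊆zs++xs∖i : ys ⊆ zs ++ toList (removeAt xs i)
      ys⊆zs++xs∖i = ⊆-trans ys⊆ (⊆.++⁺ʳ zs (toList⊆toList-removeAt xs i≢j xsᵢ≡xsⱼ))

  module _ {P : A → Set} (P? : Decidable P) where

    countDec≡length-filter : ∀ xs → countDec P? xs ≡ length (filter P? xs)
    countDec≡length-filter [] = refl
    countDec≡length-filter (x ∷ xs) with P? x
    ... | yes _ = cong suc (countDec≡length-filter xs)
    ... | no  _ = countDec≡length-filter xs

    countDec≡1⇒singleton-filter : countDec P? xs ≡ 1 → ∃ λ w → filter P? xs ≡ [ w ]
    countDec≡1⇒singleton-filter {xs} count≡1
      with filter P? xs | trans (sym (countDec≡length-filter xs)) count≡1
    ... | w ∷ [] | _ = w , refl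

    countDec≡1⇒∃ : countDec P? xs ≡ 1 → ∃ λ x → x ∈ xs × P x
    countDec≡1⇒∃ {xs} count≡1 with w , filter≡[w] ← countDec≡1⇒singleton-filter {xs} count≡1 =
      w , ∈-filter⁻ P? (subst (w ∈_) (sym filter≡[w]) (here refl))

    countDec≡1⇒unique : countDec P? xs ≡ 1 → x ∈ xs → P x → y ∈ xs → P y → x ≡ y
    countDec≡1⇒unique {xs} count≡1 x∈xs px y∈xs py
      with w , filter≡[w] ← countDec≡1⇒singleton-filter {xs} count≡1 =
      trans (is-w x∈xs px) (sym (is-w y∈xs py))
      where
      is-w : ∀ {z} → z ∈ xs → P z → z ≡ w
      is-w z∈xs pz = singleton⁻ (subst (_ ∈_) filter≡[w] (∈-filter⁺ P? z∈xs pz))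

    unique⇒countDec≡1 : Unique xs → x ∈ xs → P x → (∀ {y} → y ∈ xs → P y → y ≡ x) →
                        countDec P? xs ≡ 1
    unique⇒countDec≡1 {xs} {x} xs-unique x∈xs px only-x = begin
      countDec P? xs          ≡⟨ countDec≡length-filter xs ⟩
      length (filter P? xs)   ≡⟨ length-cong-⊆⊇ (Unique.filter⁺ P? xs-unique) ([] ∷ [])
                                                  filter⊆[x] [x]⊆filter ⟩
      length [ x ]            ∎
      where
      open ≡-Reasoning
      filter⊆[x] : filter P? xs ⊆ [ x ]
      filter⊆[x] y∈filter with y∈xs , py ← ∈-filter⁻ P? y∈filter = here (only-x y∈xs py)
      [x]⊆filter : [ x ] ⊆ filter P? xs
      [x]⊆filter (here refl) = ∈-filter⁺ P? x∈xs px

-- Geometry of 𝒯_{l,r}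

private
  variable
    l r a b c d c′ d′ x y i n : ℕ

⌊1+n+n/2⌋≡n : ∀ n → ⌊ suc (n + n) /2⌋ ≡ n
⌊1+n+n/2⌋≡n zero    = refl
⌊1+n+n/2⌋≡n (suc n) rewrite +-suc n n = cong suc (⌊1+n+n/2⌋≡n n)

l≤mid : l ≤ r → l ≤ mid l r
l≤mid {l} {r} l≤r = begin
  l              ≡⟨ n≡⌊n+n/2⌋ l ⟩
  ⌊ l + l /2⌋    ≤⟨ ⌊n/2⌋-mono (+-monoʳ-≤ l l≤r) ⟩
  mid l r        ∎
  where open ≤-Reasoning

mid<r : l < r → mid l r < r
mid<r {l} {suc r} (s≤s l≤r) = s≤s (begin
  ⌊ l + suc r /2⌋      ≤⟨ ⌊n/2⌋-mono (+-monoˡ-≤ (suc r) l≤r) ⟩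
  ⌊ r + suc r /2⌋      ≡⟨ cong ⌊_/2⌋ (+-suc r r) ⟩
  ⌊ suc (r + r) /2⌋    ≡⟨ ⌊1+n+n/2⌋≡n r ⟩
  r                    ∎)
  where open ≤-Reasoning

left-shrinks : l < r → r ∸ l < suc n → mid l r ∸ l < n
left-shrinks l<r r∸l<1+n = ≤-trans (∸-monoˡ-< (mid<r l<r) (l≤mid (<⇒≤ l<r))) (≤-pred r∸l<1+n)

right-shrinks : l < r → r ∸ l < suc n → r ∸ suc (mid l r) < n
right-shrinks l<r r∸l<1+n =
  ≤-trans (∸-monoʳ-< (s≤s (l≤mid (<⇒≤ l<r))) (mid<r l<r)) (≤-pred r∸l<1+n)

InTree-bounds : l ≤ r → InTree l r a b → l ≤ a × a ≤ b × b ≤ r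
InTree-bounds l≤r here = ≤-refl , l≤r , ≤-refl
InTree-bounds l≤r (left l<r p)
  with l≤a , a≤b , b≤m ← InTree-bounds (l≤mid l≤r) p
  = l≤a , a≤b , ≤-trans b≤m (<⇒≤ (mid<r l<r))
InTree-bounds l≤r (right l<r p)
  with m<a , a≤b , b≤r ← InTree-bounds (mid<r l<r) p
  = ≤-trans (m≤n⇒m≤1+n (l≤mid l≤r)) m<a , a≤b , b≤r

left-excludes-root : l < r → ¬ InTree l (mid l r) a r
left-excludes-root l<r p = <⇒≱ (mid<r l<r) (proj₂ (proj₂ (InTree-bounds (l≤mid (<⇒≤ l<r)) p)))

right-excludes-root : l < r → ¬ InTree (suc (mid l r)) r l b
right-excludes-root l<r p = <⇒≱ (s≤s (l≤mid (<⇒≤ l<r))) (proj₁ (InTree-bounds (mid<r l<r) p))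

left-excludes-right : l < r → InTree l (mid l r) a b → ¬ InTree (suc (mid l r)) r a b
left-excludes-right l<r p q with _ , a≤b , b≤m ← InTree-bounds (l≤mid (<⇒≤ l<r)) p =
  <⇒≱ (s≤s (≤-trans a≤b b≤m)) (proj₁ (InTree-bounds (mid<r l<r) q))

InTree-irrelevant : (p q : InTree l r a b) → p ≡ q
InTree-irrelevant here           here             = refl
InTree-irrelevant here           (left l<r q)     = contradiction q (left-excludes-root l<r)
InTree-irrelevant here           (right l<r q)    = contradiction q (right-excludes-root l<r)
InTree-irrelevant (left l<r p)   here             = contradiction p (left-excludes-root l<r)
InTree-irrelevant (right l<r p)  here             = contradiction p (right-excludes-root l<r)
InTree-irrelevant (left l<r p)   (left l<r′ q)    =
  cong₂ left (<-irrelevant l<r l<r′) (InTree-irrelevant p q)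
InTree-irrelevant (right l<r p)  (right l<r′ q)   =
  cong₂ right (<-irrelevant l<r l<r′) (InTree-irrelevant p q)
InTree-irrelevant (left l<r p)   (right _ q)      = contradiction q (left-excludes-right l<r p)
InTree-irrelevant (right _ p)    (left l<r q)     = contradiction p (left-excludes-right l<r q)

InTree-trans : InTree l r a b → InTree a b c d → InTree l r c d
InTree-trans here          q = q
InTree-trans (left l<r p)  q = left l<r (InTree-trans p q)
InTree-trans (right l<r p) q = right l<r (InTree-trans p q)

InTree-leaf : ∀ n → r ∸ l < n → l ≤ i → i ≤ r → InTree l r i i
InTree-leaf {r} {l} {i} (suc n) r∸l<1+n l≤i i≤r with l <? r | i ≤? mid l r
... | yes l<r | yes i≤m = left l<r (InTree-leaf n (left-shrinks l<r r∸l<1+n) l≤i i≤m)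
... | yes l<r | no i≰m  = right l<r (InTree-leaf n (right-shrinks l<r r∸l<1+n) (≰⇒> i≰m) i≤r)
... | no l≮r  | _
  with refl ← ≤-antisym l≤i (≤-trans i≤r (≮⇒≥ l≮r))
  with refl ← ≤-antisym i≤r (≮⇒≥ l≮r)
  = here

-- Child a b x y: the vertex labelled {x,…,y} is a child of the unlabelled child of {a,…,b}.
data Child : ℕ → ℕ → ℕ → ℕ → Set where
  left-child  : Child a b a (mid a b)
  right-child : Child a b (suc (mid a b)) b

Child⇒InTree : a < b → Child a b x y → InTree a b x y
Child⇒InTree a<b left-child  = left a<b here
Child⇒InTree a<b right-child = right a<b here

parent : InTree l r a b → Maybe (ℕ × ℕ)
parent here                  = nothing
parent {l} {r} (left _ p)    = just (fromMaybe (l , r) (parent p))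
parent {l} {r} (right _ p)   = just (fromMaybe (l , r) (parent p))

parent-child : (p : InTree l r c d) (c<d : c < d) (ch : Child c d x y) →
               parent (InTree-trans p (Child⇒InTree c<d ch)) ≡ just (c , d)
parent-child here          c<d left-child  = refl
parent-child here          c<d right-child = refl
parent-child (left _ p)    c<d ch rewrite parent-child p c<d ch = refl
parent-child (right _ p)   c<d ch rewrite parent-child p c<d ch = refl

-- InTree-irrelevant makes the parent read off a derivation a function of the label alone.
parent-unique : InTree l r c d → c < d → Child c d x y →
                InTree l r c′ d′ → c′ < d′ → Child c′ d′ x y → (c , d) ≡ (c′ , d′)
parent-unique p c<d ch p′ c′<d′ ch′ = just-injective (begin
  just (_ , _)                                    ≡⟨ sym (parent-child p c<d ch) ⟩
  parent (InTree-trans p (Child⇒InTree c<d ch))     ≡⟨ cong parent (InTree-irrelevant _ _) ⟩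
  parent (InTree-trans p′ (Child⇒InTree c′<d′ ch′)) ≡⟨ parent-child p′ c′<d′ ch′ ⟩
  just (_ , _)                                    ∎)
  where open ≡-Reasoning

root-is-not-a-child : InTree l r c d → c < d → ¬ Child c d l r
root-is-not-a-child p c<d ch
  with () ← trans (sym (parent-child p c<d ch)) (cong parent (InTree-irrelevant _ here))

range : ℕ → ℕ → List ℕ
range l r = map (l +_) (upTo (suc r ∸ l))

length-range : ∀ l r → length (range l r) ≡ suc r ∸ l
length-range l r = trans (length-map (l +_) (upTo (suc r ∸ l))) (length-upTo (suc r ∸ l))

range-unique : ∀ l r → Unique (range l r)
range-unique l r = Unique.map⁺ (+-cancelˡ-≡ l _ _) (Unique.upTo⁺ _)

∈-range⁺ : l ≤ x → x ≤ r → x ∈ range l r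
∈-range⁺ {l} {x} {r} l≤x x≤r =
  subst (_∈ range l r) (m+[n∸m]≡n l≤x) (∈-map⁺ (l +_) (∈-upTo⁺ (∸-monoˡ-< (s≤s x≤r) l≤x)))

∈-range⁻ : l ≤ r → x ∈ range l r → l ≤ x × x ≤ r
∈-range⁻ {l} {r} l≤r x∈range with j , j∈upTo , refl ← ∈-map⁻ (l +_) x∈range =
  m≤m+n l j ,
  ≤-pred (subst (l + j <_) (m+[n∸m]≡n (m≤n⇒m≤1+n l≤r)) (+-monoʳ-< l (∈-upTo⁻ j∈upTo)))

-- The first argument is fuel: halving intervals is not structural recursion.
internalNodes : ℕ → ℕ → ℕ → List (ℕ × ℕ)
internalNodes zero    l r = []
internalNodes (suc n) l r with l <? r
... | yes _ = (l , r) ∷ internalNodes n l (mid l r) ++ internalNodes n (suc (mid l r)) r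
... | no  _ = []

internalNodes-sound : ∀ n → (a , b) ∈ internalNodes n l r → InTree l r a b × a < b
internalNodes-sound {l = l} {r} (suc n) ab∈nodes with l <? r
internalNodes-sound (suc n) (here refl) | yes l<r = here , l<r
internalNodes-sound {l = l} {r} (suc n) (there ab∈nodes) | yes l<r
  with ∈-++⁻ (internalNodes n l (mid l r)) ab∈nodes
... | inj₁ ab∈left  with p , a<b ← internalNodes-sound n ab∈left  = left l<r p , a<b
... | inj₂ ab∈right with p , a<b ← internalNodes-sound n ab∈right = right l<r p , a<b

internalNodes-complete : ∀ n → r ∸ l < n → InTree l r a b → a < b → (a , b) ∈ internalNodes n l r
internalNodes-complete {r} {l} (suc n) r∸l<1+n p a<b with l <? r
internalNodes-complete (suc n) r∸l<1+n here a<b | yes l<r = here refl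
internalNodes-complete (suc n) r∸l<1+n (left _ p) a<b | yes l<r =
  there (∈-++⁺ˡ (internalNodes-complete n (left-shrinks l<r r∸l<1+n) p a<b))
internalNodes-complete {r} {l} (suc n) r∸l<1+n (right _ p) a<b | yes l<r =
  there (∈-++⁺ʳ (internalNodes n l (mid l r))
                 (internalNodes-complete n (right-shrinks l<r r∸l<1+n) p a<b))
internalNodes-complete (suc n) r∸l<1+n here        a<b | no l≮r = contradiction a<b l≮r
internalNodes-complete (suc n) r∸l<1+n (left l<r _)  a<b | no l≮r = contradiction l<r l≮r
internalNodes-complete (suc n) r∸l<1+n (right l<r _) a<b | no l≮r = contradiction l<r l≮r

internalNodes-unique : ∀ n → Unique (internalNodes n l r)
internalNodes-unique zero = []
internalNodes-unique {l} {r} (suc n) with l <? r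
... | no  _   = []
... | yes l<r =
  All.tabulate root∉subtrees ∷
  Unique.++⁺ (internalNodes-unique n) (internalNodes-unique n) subtrees-disjoint
  where
  in-tree : ∀ {l r a b} → (a , b) ∈ internalNodes n l r → InTree l r a b
  in-tree ab∈nodes = proj₁ (internalNodes-sound n ab∈nodes)
  root∉subtrees : ∀ {ab} → ab ∈ internalNodes n l (mid l r) ++ internalNodes n (suc (mid l r)) r →
                  (l , r) ≢ ab
  root∉subtrees ab∈subtrees refl with ∈-++⁻ (internalNodes n l (mid l r)) ab∈subtrees
  ... | inj₁ lr∈left  = left-excludes-root l<r (in-tree lr∈left)
  ... | inj₂ lr∈right = right-excludes-root l<r (in-tree lr∈right)
  subtrees-disjoint : ∀ {ab} →
                      ¬ (ab ∈ internalNodes n l (mid l r) × ab ∈ internalNodes n (suc (mid l r)) r)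
  subtrees-disjoint (ab∈left , ab∈right) =
    left-excludes-right l<r (in-tree ab∈left) (in-tree ab∈right)

lab-injective : ∀ {k} → lab {k} a b ≡ lab c d → a ≡ c × b ≡ d
lab-injective refl = refl , refl

-- A perfect matching forces the two conditions

module Necessity (l r : ℕ) {k : ℕ} (is : Vec ℕ k) (S : List ℕ) {M : List (Vtx k × Vtx k)}
                 (perfect : Graph.IsPerfectMatching l r is S M) where
  open Graph l r is S

  private
    variable
      u u′ v : Vtx k
      e e′ : Vtx k × Vtx k
      t t′ : Fin k

  Matched : Vtx k → Vtx k → Set
  Matched v u = (v , u) ∈ M ⊎ (u , v) ∈ M

  matched⇒Edge : Matched v u → Edge v u
  matched⇒Edge (inj₁ vu∈M) = All.lookup (proj₁ perfect) vu∈M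
  matched⇒Edge (inj₂ uv∈M) with uv , iu , iv ← All.lookup (proj₁ perfect) uv∈M = swap uv , iv , iu

  matched⇒IsVertex : Matched v u → IsVertex v × IsVertex u
  matched⇒IsVertex m = proj₂ (matched⇒Edge m)

  partner : IsVertex v → ∃ (Matched v)
  partner {v} iv
    with (w₁ , w₂) , e∈M , v∈e ← countDec≡1⇒∃ (incident? v) (proj₂ perfect v iv)
    with v∈e
  ... | inj₁ refl = w₂ , inj₁ e∈M
  ... | inj₂ refl = w₁ , inj₂ e∈M

  incident-unique : Matched v u → e ∈ M → Incident v e → e′ ∈ M → Incident v e′ → e ≡ e′
  incident-unique {v} m =
    countDec≡1⇒unique (incident? v) (proj₂ perfect v (proj₁ (matched⇒IsVertex m)))

  partner-unique : Matched v u → Matched v u′ → u ≡ u′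
  partner-unique m@(inj₁ vu∈M) (inj₁ vu′∈M)
    with refl ← incident-unique m vu∈M (inj₁ refl) vu′∈M (inj₁ refl) = refl
  partner-unique m@(inj₁ vu∈M) (inj₂ u′v∈M)
    with refl ← incident-unique m vu∈M (inj₁ refl) u′v∈M (inj₂ refl) = refl
  partner-unique m@(inj₂ uv∈M) (inj₁ vu′∈M)
    with refl ← incident-unique m uv∈M (inj₂ refl) vu′∈M (inj₁ refl) = refl
  partner-unique m@(inj₂ uv∈M) (inj₂ u′v∈M)
    with refl ← incident-unique m uv∈M (inj₂ refl) u′v∈M (inj₂ refl) = refl

  NotMatchedUp : ℕ → ℕ → Set
  NotMatchedUp x y = ∀ {c d} → Child c d x y → ¬ Matched (lab x y) (unl c d)

  partner-of-lab : NotMatchedUp a b → Matched (lab a b) u →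
                   u ≡ unl a b ⊎ ∃ λ t → u ≡ sw t × a ≡ lookup is t × b ≡ lookup is t
  partner-of-lab up m with matched⇒Edge m
  ... | inj₁ lab-unl   , _ = inj₁ refl
  ... | inj₂ unl-left  , _ = contradiction m (up left-child)
  ... | inj₂ unl-right , _ = contradiction m (up right-child)
  ... | inj₂ sw-leaf   , _ = inj₂ (_ , refl , refl , refl)

  root-not-matched-up : NotMatchedUp l r
  root-not-matched-up ch m with p , c<d ← proj₂ (matched⇒IsVertex m) = root-is-not-a-child p c<d ch

  internal-matched-down : InTree l r a b → a < b → NotMatchedUp a b → Matched (lab a b) (unl a b)
  internal-matched-down p a<b up
    with u , m ← partner (p , λ (a≡b , _) → <⇒≢ a<b a≡b)
    with partner-of-lab up m
  ... | inj₁ refl                   = m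
  ... | inj₂ (_ , _ , a≡iₜ , b≡iₜ)  = contradiction (trans a≡iₜ (sym b≡iₜ)) (<⇒≢ a<b)

  child-not-matched-up : InTree l r a b → a < b → NotMatchedUp a b →
                         Child a b x y → NotMatchedUp x y
  child-not-matched-up p a<b up ch ch′ m
    with p′ , c<d ← proj₂ (matched⇒IsVertex m)
    with refl ← parent-unique p a<b ch p′ c<d ch′
    with refl ← partner-unique (swap m) (swap (internal-matched-down p a<b up))
    = root-is-not-a-child here a<b ch

  not-matched-up-below : InTree l r a b → NotMatchedUp a b → InTree a b x y → NotMatchedUp x y
  not-matched-up-below p up here = up
  not-matched-up-below p up (left a<b q) =
    not-matched-up-below (InTree-trans p (left a<b here))
                         (child-not-matched-up p a<b up left-child) q
  not-matched-up-below p up (right a<b q) =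
    not-matched-up-below (InTree-trans p (right a<b here))
                         (child-not-matched-up p a<b up right-child) q

  leaf-matched-to-switch : InTree l r i i → i ∉ S → ∃ λ t → lookup is t ≡ i
  leaf-matched-to-switch p i∉S
    with u , m ← partner (p , λ (_ , i∈S) → i∉S i∈S)
    with partner-of-lab (not-matched-up-below here root-not-matched-up p) m
  ... | inj₁ refl              = contradiction (proj₂ (proj₂ (matched⇒IsVertex m))) (<-irrefl refl)
  ... | inj₂ (t , _ , i≡iₜ , _) = t , sym i≡iₜ

  switch-matched : Matched (sw t) (lab (lookup is t) (lookup is t))
  switch-matched {t} with u , m ← partner {sw t} tt with matched⇒Edge m
  ... | inj₁ sw-leaf , _ = m

  switch-leaf∉S : lookup is t ∉ S
  switch-leaf∉S iₜ∈S = proj₂ (proj₂ (matched⇒IsVertex switch-matched)) (refl , iₜ∈S)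

  switches-injective : lookup is t ≡ lookup is t′ → t ≡ t′
  switches-injective {t} {t′} iₜ≡iₜ′
    with refl ← partner-unique (swap (switch-matched {t}))
                  (subst (λ i → Matched (lab i i) (sw t′)) (sym iₜ≡iₜ′) (swap switch-matched))
    = refl

  leaf-deleted-or-switched : l ≤ x → x ≤ r → x ∈ S ⊎ ∃ λ t → lookup is t ≡ x
  leaf-deleted-or-switched {x} l≤x x≤r with x ∈ₗ? S
  ... | yes x∈S = inj₁ x∈S
  ... | no  x∉S = inj₂ (leaf-matched-to-switch (InTree-leaf (suc (r ∸ l)) ≤-refl l≤x x≤r) x∉S)

  S-exact : All (λ s → l ≤ s × s ≤ r) S → ∀ x → x ∈ S ⇔ (l ≤ x × x ≤ r × ¬ x ∈ᵥ is)
  S-exact S-bounded x = mk⇔ to from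
    where
    to : x ∈ S → l ≤ x × x ≤ r × ¬ x ∈ᵥ is
    to x∈S with l≤x , x≤r ← All.lookup S-bounded x∈S =
      l≤x , x≤r , λ x∈is → switch-leaf∉S (subst (_∈ S) (lookup-index x∈is) x∈S)
    from : l ≤ x × x ≤ r × ¬ x ∈ᵥ is → x ∈ S
    from (l≤x , x≤r , x∉is) with leaf-deleted-or-switched l≤x x≤r
    ... | inj₁ x∈S        = x∈S
    ... | inj₂ (t , refl) = contradiction (∈ᵥ-lookup t is) x∉is

  |S|+k≡|leaves| : l ≤ r → Allᵥ (λ i → l ≤ i × i ≤ r) is → Unique S → All (λ s → l ≤ s × s ≤ r) S →
                   length S + k ≡ suc r ∸ l
  |S|+k≡|leaves| l≤r is-bounded S-unique S-bounded = begin
    length S + k                          ≡⟨ cong (length S +_) (length-tabulate (lookup is)) ⟨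
    length S + length switchLeaves        ≡⟨ length-++ S ⟨
    length (S ++ switchLeaves)            ≡⟨ length-cong-⊆⊇ S++switchLeaves-unique (range-unique l r)
                                                            ⊆range range⊆ ⟩
    length (range l r)                    ≡⟨ length-range l r ⟩
    suc r ∸ l                             ∎
    where
    open ≡-Reasoning
    switchLeaves : List ℕ
    switchLeaves = tabulate (lookup is)
    S++switchLeaves-unique : Unique (S ++ switchLeaves)
    S++switchLeaves-unique = Unique.++⁺ S-unique (Unique.tabulate⁺ switches-injective) disjoint
      where
      disjoint : ∀ {x} → ¬ (x ∈ S × x ∈ switchLeaves)
      disjoint (x∈S , x∈switchLeaves) with t , refl ← ∈-tabulate⁻ x∈switchLeaves = switch-leaf∉S x∈S
    ⊆range : S ++ switchLeaves ⊆ range l r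
    ⊆range x∈S++ with ∈-++⁻ S x∈S++
    ... | inj₁ x∈S = uncurry ∈-range⁺ (All.lookup S-bounded x∈S)
    ... | inj₂ x∈switchLeaves with t , refl ← ∈-tabulate⁻ x∈switchLeaves =
      uncurry ∈-range⁺ (lookupᵥ is-bounded (∈ᵥ-lookup t is))
    range⊆ : range l r ⊆ S ++ switchLeaves
    range⊆ x∈range with uncurry leaf-deleted-or-switched (∈-range⁻ l≤r x∈range)
    ... | inj₁ x∈S        = ∈-++⁺ˡ x∈S
    ... | inj₂ (t , refl) = ∈-++⁺ʳ S (∈-tabulate⁺ t)

-- The perfect matching under the two conditions

module Sufficiency (l r : ℕ) {k : ℕ} (is : Vec ℕ k) (S : List ℕ) (l≤r : l ≤ r)
                   (is-bounded : Allᵥ (λ i → l ≤ i × i ≤ r) is)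
                   (S-exact : ∀ x → x ∈ S ⇔ (l ≤ x × x ≤ r × ¬ x ∈ᵥ is))
                   (sizes : length S + k ≡ suc r ∸ l) where
  open Graph l r is S

  private
    variable
      e : Vtx k × Vtx k
      t t′ : Fin k

  switch-leaf∉S : lookup is t ∉ S
  switch-leaf∉S {t} iₜ∈S = proj₂ (proj₂ (Equivalence.to (S-exact _) iₜ∈S)) (∈ᵥ-lookup t is)

  switches-injective : lookup is t ≡ lookup is t′ → t ≡ t′
  switches-injective =
    covering⇒lookup-injective is (range-unique l r) range⊆ (trans (length-range l r) (sym sizes))
    where
    range⊆ : range l r ⊆ S ++ toList is
    range⊆ {x} x∈range with l≤x , x≤r ← ∈-range⁻ l≤r x∈range with x ∈ᵥ? is
    ... | yes x∈is = ∈-++⁺ʳ S (∈-toList⁺ x∈is)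
    ... | no  x∉is = ∈-++⁺ˡ (Equivalence.from (S-exact x) (l≤x , x≤r , x∉is))

  treeEdge : ℕ × ℕ → Vtx k × Vtx k
  treeEdge (a , b) = lab a b , unl a b

  switchEdge : Fin k → Vtx k × Vtx k
  switchEdge t = sw t , lab (lookup is t) (lookup is t)

  nodes : List (ℕ × ℕ)
  nodes = internalNodes (suc (r ∸ l)) l r

  matching : List (Vtx k × Vtx k)
  matching = map treeEdge nodes ++ map switchEdge (allFin k)

  ∈-matching⁻ : e ∈ matching → (∃ λ ab → ab ∈ nodes × e ≡ treeEdge ab) ⊎ (∃ λ t → e ≡ switchEdge t)
  ∈-matching⁻ e∈M with ∈-++⁻ (map treeEdge nodes) e∈M
  ... | inj₁ e∈tree   = inj₁ (∈-map⁻ treeEdge e∈tree)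
  ... | inj₂ e∈switch with t , _ , e≡ ← ∈-map⁻ switchEdge e∈switch = inj₂ (t , e≡)

  treeEdge∈matching : InTree l r a b → a < b → treeEdge (a , b) ∈ matching
  treeEdge∈matching p a<b = ∈-++⁺ˡ (∈-map⁺ treeEdge (internalNodes-complete _ ≤-refl p a<b))

  switchEdge∈matching : ∀ t → switchEdge t ∈ matching
  switchEdge∈matching t = ∈-++⁺ʳ (map treeEdge nodes) (∈-map⁺ switchEdge (∈-allFin t))

  matching-unique : Unique matching
  matching-unique = Unique.++⁺ (Unique.map⁺ treeEdge-injective (internalNodes-unique _))
                               (Unique.map⁺ switchEdge-injective (Unique.allFin⁺ k)) disjoint
    where
    treeEdge-injective : ∀ {ab cd} → treeEdge ab ≡ treeEdge cd → ab ≡ cd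
    treeEdge-injective {_ , _} {_ , _} refl = refl
    switchEdge-injective : switchEdge t ≡ switchEdge t′ → t ≡ t′
    switchEdge-injective refl = refl
    disjoint : ¬ (e ∈ map treeEdge nodes × e ∈ map switchEdge (allFin k))
    disjoint (e∈tree , e∈switch) with ∈-map⁻ treeEdge e∈tree | ∈-map⁻ switchEdge e∈switch
    ... | _ , _ , refl | _ , _ , ()

  matching-edges : All (λ e → Edge (proj₁ e) (proj₂ e)) matching
  matching-edges = All.tabulate λ e∈M → edge (∈-matching⁻ e∈M)
    where
    edge : (∃ λ ab → ab ∈ nodes × e ≡ treeEdge ab) ⊎ (∃ λ t → e ≡ switchEdge t) →
           Edge (proj₁ e) (proj₂ e)
    edge (inj₁ ((a , b) , ab∈nodes , refl)) with p , a<b ← internalNodes-sound _ ab∈nodes =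
      inj₁ lab-unl , (p , λ (a≡b , _) → <⇒≢ a<b a≡b) , (p , a<b)
    edge (inj₂ (t , refl)) with l≤iₜ , iₜ≤r ← lookupᵥ is-bounded (∈ᵥ-lookup t is) =
      inj₁ sw-leaf , tt , (InTree-leaf _ ≤-refl l≤iₜ iₜ≤r , λ (_ , iₜ∈S) → switch-leaf∉S iₜ∈S)

  degree-one : ∀ {v} → e ∈ matching → Incident v e →
               (∀ {e′} → e′ ∈ matching → Incident v e′ → e′ ≡ e) →
               countDec (incident? v) matching ≡ 1
  degree-one {v = v} = unique⇒countDec≡1 (incident? v) matching-unique

  internal-lab-degree : InTree l r a b → a < b → countDec (incident? (lab a b)) matching ≡ 1
  internal-lab-degree {a} {b} p a<b = degree-one (treeEdge∈matching p a<b) (inj₁ refl) only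
    where
    only : e ∈ matching → Incident (lab a b) e → e ≡ treeEdge (a , b)
    only e∈M e∋v with ∈-matching⁻ e∈M
    only _ (inj₁ refl) | inj₁ ((_ , _) , _ , refl) = refl
    only _ (inj₂ ())   | inj₁ ((_ , _) , _ , refl)
    only _ (inj₁ ())   | inj₂ (_ , refl)
    only _ (inj₂ lab≡) | inj₂ (_ , refl) with iₜ≡a , iₜ≡b ← lab-injective lab≡ =
      contradiction (trans (sym iₜ≡a) iₜ≡b) (<⇒≢ a<b)

  unl-degree : InTree l r a b → a < b → countDec (incident? (unl a b)) matching ≡ 1
  unl-degree {a} {b} p a<b = degree-one (treeEdge∈matching p a<b) (inj₂ refl) only
    where
    only : e ∈ matching → Incident (unl a b) e → e ≡ treeEdge (a , b)
    only e∈M e∋v with ∈-matching⁻ e∈M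
    only _ (inj₁ ())   | inj₁ ((_ , _) , _ , refl)
    only _ (inj₂ refl) | inj₁ ((_ , _) , _ , refl) = refl
    only _ (inj₁ ())   | inj₂ (_ , refl)
    only _ (inj₂ ())   | inj₂ (_ , refl)

  switch-degree : ∀ t → countDec (incident? (sw t)) matching ≡ 1
  switch-degree t = degree-one (switchEdge∈matching t) (inj₁ refl) only
    where
    only : e ∈ matching → Incident (sw t) e → e ≡ switchEdge t
    only e∈M e∋v with ∈-matching⁻ e∈M
    only _ (inj₁ ())   | inj₁ ((_ , _) , _ , refl)
    only _ (inj₂ ())   | inj₁ ((_ , _) , _ , refl)
    only _ (inj₁ refl) | inj₂ (_ , refl) = refl
    only _ (inj₂ ())   | inj₂ (_ , refl)

  switch-leaf-degree : ∀ t → countDec (incident? (lab (lookup is t) (lookup is t))) matching ≡ 1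
  switch-leaf-degree t = degree-one (switchEdge∈matching t) (inj₂ refl) only
    where
    only : e ∈ matching → Incident (lab (lookup is t) (lookup is t)) e → e ≡ switchEdge t
    only e∈M e∋v with ∈-matching⁻ e∈M
    only _ (inj₁ lab≡) | inj₁ ((_ , _) , cd∈nodes , refl)
      with c≡iₜ , d≡iₜ ← lab-injective lab≡ =
      contradiction (trans c≡iₜ (sym d≡iₜ)) (<⇒≢ (proj₂ (internalNodes-sound _ cd∈nodes)))
    only _ (inj₂ ())   | inj₁ ((_ , _) , _ , refl)
    only _ (inj₁ ())   | inj₂ (_ , refl)
    only _ (inj₂ lab≡) | inj₂ (_ , refl) =
      cong switchEdge (switches-injective (proj₁ (lab-injective lab≡)))

  leaf-degree : InTree l r x x → x ∉ S → countDec (incident? (lab x x)) matching ≡ 1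
  leaf-degree {x} p x∉S with x ∈ᵥ? is
  ... | yes x∈is = subst (λ i → countDec (incident? (lab i i)) matching ≡ 1)
                         (sym (lookup-index x∈is)) (switch-leaf-degree _)
  ... | no  x∉is with l≤x , _ , x≤r ← InTree-bounds l≤r p =
    contradiction (Equivalence.from (S-exact x) (l≤x , x≤r , x∉is)) x∉S

  matching-perfect : IsPerfectMatching matching
  matching-perfect = matching-edges , degree
    where
    degree : ∀ v → IsVertex v → countDec (incident? v) matching ≡ 1
    degree (lab a b) (p , not-deleted) with a <? b
    ... | yes a<b = internal-lab-degree p a<b
    ... | no  a≮b with refl ← ≤-antisym (proj₁ (proj₂ (InTree-bounds l≤r p))) (≮⇒≥ a≮b) =
      leaf-degree p (λ a∈S → not-deleted (refl , a∈S))
    degree (unl a b) (p , a<b) = unl-degree p a<b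
    degree (sw t)    _         = switch-degree t

lemma3p6 : (l r k : ℕ) → 1 ≤ l → l ≤ r →
    (is : Vec ℕ k) → Allᵥ (λ i → l ≤ i × i ≤ r) is →
    (S : List ℕ) → Unique S → All (λ s → l ≤ s × s ≤ r) S →
    Graph.HasPerfectMatching l r is S ⇔
      ((∀ x → x ∈ S ⇔ (l ≤ x × x ≤ r × ¬ (x ∈ᵥ is))) × length S + k ≡ suc r ∸ l)
lemma3p6 l r k _ l≤r is is-bounded S S-unique S-bounded = mk⇔
  (λ (_ , perfect) → let open Necessity l r is S perfect in
    S-exact S-bounded , |S|+k≡|leaves| l≤r is-bounded S-unique S-bounded)
  (λ (S-exact , sizes) → _ , Sufficiency.matching-perfect l r is S l≤r is-bounded S-exact sizes)
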